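{- Let $n \geq 0$ and $m \geq 1$ be integers. Write a partition $\lambda$ of $n$ as $\lambda = (\lambda_1 \geq \lambda_2 \geq \cdots \geq \lambda_\ell)$. Let $C_m(n)$ be the set of partitions $\lambda$ of $n$ for which there exist indices $1 \leq i_1 < i_2 < \cdots < i_m \leq \ell$ with $\lambda_{i_j} - \lambda_{i_{j+1}} \geq 2$ for all $1 \leq j \leq m-1$ (i.e. there is a subsequence of length $m$ of the parts in which any two consecutive members differ by at least $2$). Let $D_m(n)$ be the set of partitions of $n$ having at least $m$ parts greater than or equal to $m$. Then $|C_m(n)| = |D_m(n)|$.
   Context: Partitions are finite nonincreasing sequences of positive integers; a part counted with multiplicity contributes one entry to the sequence. -}

module Defs where

open import Data.Nat using (ℕ; zero; suc; _+_; _≤_; _≥_; _<_; _≤?_)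
open import Data.Nat.Properties using (_≟_)
open import Data.List using (List; []; _∷_; length; map; _++_; filter)
open import Data.Nat.ListAction using (sum)
open import Data.List.Relation.Unary.All using (All)
open import Data.List.Relation.Unary.Any using (Any; any?)
open import Data.List.Relation.Unary.Linked using (Linked)
open import Data.Product using (Σ; _×_)
open import Data.Bool using (T)
open import Relation.Nullary using (Dec; ⌊_⌋)
open import Relation.Binary.PropositionalEquality using (_≡_)
open import Function.Bundles using (_↔_)

IsPartition : ℕ → List ℕ → Set
IsPartition n p = Linked _≥_ p × All (λ x → 1 ≤ x) p × sum p ≡ n

subsequences : List ℕ → List (List ℕ)
subsequences []       = [] ∷ []
subsequences (x ∷ xs) = map (x ∷_) (subsequences xs) ++ subsequences xs

Gap2 : List ℕ → Set
Gap2 = Linked (λ a b → 2 + b ≤ a)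

HasGapSubseq : ℕ → List ℕ → Set
HasGapSubseq m p = Any (λ s → length s ≡ m × Gap2 s) (subsequences p)

countGe : ℕ → List ℕ → ℕ
countGe m p = length (filter (m ≤?_) p)

HasManyLargeParts : ℕ → List ℕ → Set
HasManyLargeParts m p = m ≤ countGe m p

hasGapSubseq? : (m : ℕ) (p : List ℕ) → Dec (HasGapSubseq m p)
hasGapSubseq? m p = any? (λ s → dec s) (subsequences p)
  where
  open import Relation.Nullary using (_×-dec_)
  open import Data.List.Relation.Unary.Linked.Properties using ()
  import Data.List.Relation.Unary.Linked as L
  dec : (s : List ℕ) → Dec (length s ≡ m × Gap2 s)
  dec s = (length s ≟ m) ×-dec L.linked? (λ a b → (2 + b) ≤? a) s

-- C_m(n) and D_m(n) as subtypes of List ℕ (all components are propositions;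
-- the existential in C_m is made proof-irrelevant via its decision procedure).
C : ℕ → ℕ → Set
C m n = Σ (List ℕ) (λ p → IsPartition n p × T ⌊ hasGapSubseq? m p ⌋)

D : ℕ → ℕ → Set
D m n = Σ (List ℕ) (λ p → IsPartition n p × HasManyLargeParts m p)

-- A partition splits uniquely, reading from its smallest part, into d clusters: runs of parts b and b + 1
-- whose bases b increase by at least 2.  A gap-2 subsequence meets each cluster at most once and the bases
-- form one, so the longest has length d.  Likewise "at least m parts ≥ m" says that the Durfee square has
-- side d ≥ m.  Both statistics have the same distribution: adding clusters one at a time, from the top,
-- builds a weight-preserving bijection between d clusters and partitions with a d × d Durfee square.

module Submission where

open import Defs
open import Data.Nat using (ℕ; zero; suc; pred; _+_; _*_; _∸_; _≤_; _≥_; _<_; z≤n; s≤s; _≤?_)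
open import Data.Nat.Properties
open import Data.Nat.ListAction using (sum)
open import Data.Nat.ListAction.Properties using (sum-++)
open import Data.Nat.Solver using (module +-*-Solver)
open import Data.Product using (Σ; ∃; _×_; _,_; proj₁; proj₂; uncurry)
open import Data.Product.Properties using (Σ-≡,≡→≡)
open import Data.Product.Function.Dependent.Propositional using (Σ-↔)
open import Data.Vec using (Vec; []; _∷_; toList; head; init; last; _∷ʳ_; initLast)
open import Data.Vec.Properties using (length-toList; init-∷ʳ; last-∷ʳ)
open import Data.List using (List; []; _∷_; _++_; [_]; length; map; replicate; foldr; reverse; filter)
open import Data.List.Properties
  using (foldr-++; length-++; ++-identityʳ; ++-assoc; unfold-reverse; reverse-involutive; length-reverse;
         filter-all; filter-none; filter-++; length-filter)
open import Data.List.Relation.Unary.All as All using (All; []; _∷_)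
import Data.List.Relation.Unary.All.Properties as All
open import Data.List.Relation.Unary.Any using (Any; here)
import Data.List.Relation.Unary.Any.Properties as Any
open import Data.List.Relation.Unary.Linked as Linked using (Linked; []; [-]; _∷_)
open import Data.List.Relation.Binary.Sublist.Propositional as Sublist using (_⊆_; []; _∷_)
open import Data.List.Relation.Binary.Sublist.Propositional.Properties
  using (All-resp-⊆; ++⁺; ++⁺ˡ; []⊆-universal)
open import Data.Sum using (inj₁; inj₂)
open import Data.Empty using (⊥-elim)
open import Data.Bool using (T)
open import Data.Bool.Properties using (T-irrelevant)
open import Relation.Nullary using (Irrelevant; yes; no; contradiction; ⌊_⌋)
open import Relation.Nullary.Decidable using (toWitness; fromWitness)
open import Relation.Binary.PropositionalEquality
  using (_≡_; refl; sym; trans; cong; cong₂; subst; module ≡-Reasoning)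
open import Function.Base using (_∘_)
open import Function.Bundles using (_↔_; _⇔_; mk↔ₛ′; mk⇔; Equivalence; Inverse)
open import Function.Properties.Inverse using (↔-refl)
open import Function.Related.Propositional using (module EquationalReasoning)
import Function.Properties.Equivalence as ⇔

open +-*-Solver using (solve; _:=_; _:+_; _:*_; con)

module _ {A : Set} {R : A → A → Set} where

  Linked-++⁻ˡ : ∀ xs {ys} → Linked R (xs ++ ys) → Linked R xs
  Linked-++⁻ˡ []           _       = []
  Linked-++⁻ˡ (x ∷ [])     _       = [-]
  Linked-++⁻ˡ (x ∷ y ∷ xs) (r ∷ l) = r ∷ Linked-++⁻ˡ (y ∷ xs) l

  Linked-++⁻ʳ : ∀ xs {ys} → Linked R (xs ++ ys) → Linked R ys
  Linked-++⁻ʳ []       l = l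
  Linked-++⁻ʳ (x ∷ xs) l = Linked-++⁻ʳ xs (Linked.tail l)

nonincreasing⇒bounded : ∀ {x p} → Linked _≥_ (x ∷ p) → All (_≤ x) p
nonincreasing⇒bounded [-]     = []
nonincreasing⇒bounded (h ∷ l) = h ∷ All.map (λ q → ≤-trans q h) (nonincreasing⇒bounded l)

nonincreasing-++ : ∀ c {xs ys} → Linked _≥_ xs → All (c ≤_) xs → Linked _≥_ ys → All (_≤ c) ys →
                   Linked _≥_ (xs ++ ys)
nonincreasing-++ c []      _         ly _         = ly
nonincreasing-++ c {x ∷ []} {[]} [-] _ _ _         = [-]
nonincreasing-++ c {x ∷ []} {y ∷ ys} [-] (hx ∷ _) ly (hy ∷ _) = ≤-trans hy hx ∷ ly
nonincreasing-++ c (h ∷ lx) (_ ∷ hxs) ly hys = h ∷ nonincreasing-++ c lx hxs ly hys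

nonincreasing-replicate : ∀ n x → Linked _≥_ (replicate n x)
nonincreasing-replicate zero          x = []
nonincreasing-replicate (suc zero)    x = [-]
nonincreasing-replicate (suc (suc n)) x = ≤-refl ∷ nonincreasing-replicate (suc n) x

sum-replicate : ∀ n x → sum (replicate n x) ≡ n * x
sum-replicate zero    x = refl
sum-replicate (suc n) x = cong (x +_) (sum-replicate n x)

Gap2-∷ʳ : ∀ b s → Gap2 s → All (2 + b ≤_) s → Gap2 (s ++ [ b ])
Gap2-∷ʳ b []           _       _        = [-]
Gap2-∷ʳ b (x ∷ [])     _       (h ∷ _)  = h ∷ [-]
Gap2-∷ʳ b (x ∷ y ∷ s)  (g ∷ l) (_ ∷ hs) = g ∷ Gap2-∷ʳ b (y ∷ s) l hs

Gap2-within-[b,b+1] : ∀ b s → Gap2 s → All (b ≤_) s → All (_≤ suc b) s → length s ≤ 1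
Gap2-within-[b,b+1] b []          _       _            _        = z≤n
Gap2-within-[b,b+1] b (x ∷ [])    _       _            _        = s≤s z≤n
Gap2-within-[b,b+1] b (x ∷ y ∷ s) (g ∷ _) (_ ∷ hy ∷ _) (hx ∷ _) =
  ⊥-elim (<-irrefl refl (≤-trans (s≤s (s≤s hy)) (≤-trans g hx)))

⊆-++-split : ∀ xs {ys s : List ℕ} → s ⊆ xs ++ ys →
             ∃ λ s₁ → ∃ λ s₂ → s ≡ s₁ ++ s₂ × s₁ ⊆ xs × s₂ ⊆ ys
⊆-++-split []       {s = s} τ = [] , s , refl , [] , τ
⊆-++-split (x ∷ xs) (.x Sublist.∷ʳ τ) with ⊆-++-split xs τ
... | s₁ , s₂ , refl , τ₁ , τ₂ = s₁ , s₂ , refl , x Sublist.∷ʳ τ₁ , τ₂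
⊆-++-split (x ∷ xs) (refl ∷ τ) with ⊆-++-split xs τ
... | s₁ , s₂ , refl , τ₁ , τ₂ = x ∷ s₁ , s₂ , refl , refl ∷ τ₁ , τ₂

subsequences⁺ : ∀ {Q : List ℕ → Set} {s xs} → s ⊆ xs → Q s → Any Q (subsequences xs)
subsequences⁺ []                       q = here q
subsequences⁺ {xs = x ∷ xs} (.x Sublist.∷ʳ τ)  q = Any.++⁺ʳ (map (x ∷_) (subsequences xs)) (subsequences⁺ τ q)
subsequences⁺ {Q} (refl ∷ τ)           q = Any.++⁺ˡ (Any.map⁺ (subsequences⁺ {λ t → Q (_ ∷ t)} τ q))

subsequences⁻ : ∀ {Q : List ℕ → Set} xs → Any Q (subsequences xs) → ∃ λ s → s ⊆ xs × Q s
subsequences⁻ []           (here q) = [] , [] , q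
subsequences⁻ {Q} (x ∷ xs) a with Any.++⁻ (map (x ∷_) (subsequences xs)) a
... | inj₁ a₁ with subsequences⁻ {λ s → Q (x ∷ s)} xs (Any.map⁻ a₁)
...   | s , τ , q = x ∷ s , refl ∷ τ , q
subsequences⁻ (x ∷ xs) a | inj₂ a₂ with subsequences⁻ xs a₂
...   | s , τ , q = s , x Sublist.∷ʳ τ , q

IsPartition-irrelevant : ∀ {n p} → Irrelevant (IsPartition n p)
IsPartition-irrelevant (l₁ , pos₁ , s₁) (l₂ , pos₂ , s₂) =
  cong₂ _,_ (Linked.irrelevant ≤-irrelevant l₁ l₂)
            (cong₂ _,_ (All.irrelevant ≤-irrelevant pos₁ pos₂) (≡-irrelevant s₁ s₂))

-- X d encodes the partitions on which some statistic takes the value d.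
record PartitionCode (X : ℕ → Set) : Set where
  field
    weight            : ∀ {d} → X d → ℕ
    encode            : ∀ {d} → X d → List ℕ
    decode            : List ℕ → Σ ℕ X
    encode-partition  : ∀ {d} (x : X d) → IsPartition (weight x) (encode x)
    decode-encode     : ∀ {d} (x : X d) → decode (encode x) ≡ (d , x)
    encode-decode     : ∀ {n p} → IsPartition n p → encode (proj₂ (decode p)) ≡ p

  Codes : ℕ → ℕ → Set
  Codes n m = Σ (Σ ℕ X) λ (d , x) → weight {d} x ≡ n × m ≤ d

  partitions↔codes : ∀ {n m} (Q : List ℕ → Set) → (∀ {p} → Irrelevant (Q p)) →
                     (∀ {d} (x : X d) → Q (encode x) ⇔ m ≤ d) →
                     Σ (List ℕ) (λ p → IsPartition n p × Q p) ↔ Codes n m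
  partitions↔codes {n} {m} Q Q-irrelevant Q⇔ = mk↔ₛ′ to from to∘from from∘to
    where
    to : Σ (List ℕ) (λ p → IsPartition n p × Q p) → Codes n m
    to (p , part , q) = decode p , weight≡n , Equivalence.to (Q⇔ x) (subst Q (sym x↦p) q)
      where
      x = proj₂ (decode p)
      x↦p = encode-decode part
      weight≡n : weight x ≡ n
      weight≡n = trans (sym (proj₂ (proj₂ (encode-partition x))))
                       (trans (cong sum x↦p) (proj₂ (proj₂ part)))
    from : Codes n m → Σ (List ℕ) (λ p → IsPartition n p × Q p)
    from ((d , x) , w , h) =
      encode x , subst (λ k → IsPartition k (encode x)) w (encode-partition x) , Equivalence.from (Q⇔ x) h
    to∘from : ∀ c → to (from c) ≡ c
    to∘from ((d , x) , _ , _) = Σ-≡,≡→≡ (decode-encode x , cong₂ _,_ (≡-irrelevant _ _) (≤-irrelevant _ _))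
    from∘to : ∀ p → from (to p) ≡ p
    from∘to (p , part , q) = Σ-≡,≡→≡ (encode-decode part , cong₂ _,_ (IsPartition-irrelevant _ _) (Q-irrelevant _ _))

open PartitionCode using (Codes; weight; partitions↔codes)

Codes-↔ : ∀ {X Y} (codeX : PartitionCode X) (codeY : PartitionCode Y) (e : ∀ {d} → X d ↔ Y d) →
          (∀ {d} (x : X d) → weight codeY (Inverse.to e x) ≡ weight codeX x) →
          ∀ {n m} → Codes codeX n m ↔ Codes codeY n m
Codes-↔ codeX codeY e preserves {n} {m} =
  Σ-↔ (Σ-↔ ↔-refl e) λ {(d , x)} →
    subst (λ w → (weight codeX x ≡ n × m ≤ d) ↔ (w ≡ n × m ≤ d)) (sym (preserves x)) ↔-refl

-- Cluster decomposition

-- A cluster (s , k , j) above the floor w is the clusterBlock of k + 1 parts b = s + w and j parts b + 1;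
-- the next cluster has floor b + 2.  Clusters are listed from the smallest parts upwards.
Cluster : Set
Cluster = ℕ × ℕ × ℕ

Clusters : ℕ → Set
Clusters d = Vec Cluster d

clusterBlock : ℕ → ℕ → ℕ → List ℕ
clusterBlock b k j = replicate j (suc b) ++ replicate (suc k) b

clusterParts : ∀ {d} → ℕ → Clusters d → List ℕ
clusterParts w []                = []
clusterParts w ((s , k , j) ∷ cs) = clusterParts (2 + (s + w)) cs ++ clusterBlock (s + w) k j

clustersWeight : ∀ {d} → ℕ → Clusters d → ℕ
clustersWeight w []                = 0
clustersWeight w ((s , k , j) ∷ cs) = suc k * (s + w) + j * suc (s + w) + clustersWeight (2 + (s + w)) cs

clusterBlock-≥ : ∀ b k j → All (b ≤_) (clusterBlock b k j)
clusterBlock-≥ b k j = All.++⁺ (All.replicate⁺ j (n≤1+n b)) (All.replicate⁺ (suc k) ≤-refl)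

clusterBlock-≤ : ∀ b k j → All (_≤ suc b) (clusterBlock b k j)
clusterBlock-≤ b k j = All.++⁺ (All.replicate⁺ j ≤-refl) (All.replicate⁺ (suc k) (n≤1+n b))

clusterParts-≥ : ∀ {d} w (cs : Clusters d) → All (w ≤_) (clusterParts w cs)
clusterParts-≥ w []                = []
clusterParts-≥ w ((s , k , j) ∷ cs) =
  All.++⁺ (All.map (≤-trans (≤-trans (m≤n+m w s) (m≤n+m (s + w) 2))) (clusterParts-≥ (2 + (s + w)) cs))
          (All.map (≤-trans (m≤n+m w s)) (clusterBlock-≥ (s + w) k j))

clusterParts-nonincreasing : ∀ {d} w (cs : Clusters d) → Linked _≥_ (clusterParts w cs)
clusterParts-nonincreasing w []                = []
clusterParts-nonincreasing w ((s , k , j) ∷ cs) =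
  nonincreasing-++ (suc (s + w)) (clusterParts-nonincreasing (2 + (s + w)) cs)
    (All.map (≤-trans (n≤1+n (suc (s + w)))) (clusterParts-≥ (2 + (s + w)) cs))
    (nonincreasing-++ (s + w) (nonincreasing-replicate j (suc (s + w))) (All.replicate⁺ j (n≤1+n (s + w)))
                              (nonincreasing-replicate (suc k) (s + w)) (All.replicate⁺ (suc k) ≤-refl))
    (clusterBlock-≤ (s + w) k j)

sum-clusterParts : ∀ {d} w (cs : Clusters d) → sum (clusterParts w cs) ≡ clustersWeight w cs
sum-clusterParts w []                = refl
sum-clusterParts w ((s , k , j) ∷ cs)
  rewrite sum-++ (clusterParts (2 + (s + w)) cs) (clusterBlock (s + w) k j)
        | sum-++ (replicate j (suc (s + w))) (replicate (suc k) (s + w))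
        | sum-replicate j (suc (s + w)) | sum-replicate (suc k) (s + w)
        | sum-clusterParts (2 + (s + w)) cs =
  solve 4 (λ I A B C → I :+ (A :+ (B :+ C)) := B :+ C :+ A :+ I) refl
    (clustersWeight (2 + (s + w)) cs) (j * suc (s + w)) (s + w) (k * (s + w))

-- Decoding: parts are inserted from the smallest one, each either joining the top cluster or opening a new one.
consCluster : Cluster → Σ ℕ Clusters → Σ ℕ Clusters
consCluster c (d , cs) = suc d , c ∷ cs

extendTop′ : ℕ → ℕ → ℕ → ℕ → ℕ → Σ ℕ Clusters
extendTop′ w x s k j with x ≤? suc (s + w)
... | yes _ = 1 , (s , k , suc j) ∷ []
... | no _  = 2 , (s , k , j) ∷ (x ∸ (2 + (s + w)) , 0 , 0) ∷ []

extendTop : ℕ → ℕ → ℕ → ℕ → ℕ → Σ ℕ Clusters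
extendTop w x s k j with x ≤? s + w
... | yes _ = 1 , (s , suc k , j) ∷ []
... | no _  = extendTop′ w x s k j

insertPart : ℕ → ℕ → ∀ {d} → Clusters d → Σ ℕ Clusters
insertPart w x []                      = 1 , (x ∸ w , 0 , 0) ∷ []
insertPart w x ((s , k , j) ∷ [])      = extendTop w x s k j
insertPart w x ((s , k , j) ∷ c ∷ cs)  = consCluster (s , k , j) (insertPart (2 + (s + w)) x (c ∷ cs))

insertPartΣ : ℕ → ℕ → Σ ℕ Clusters → Σ ℕ Clusters
insertPartΣ w x (_ , cs) = insertPart w x cs

clustersOf : ℕ → List ℕ → Σ ℕ Clusters
clustersOf w = foldr (insertPartΣ w) (0 , [])

insertPart-above : ∀ {d} w x s k j (cs : Clusters d) → 2 + (s + w) ≤ x →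
                   insertPart w x ((s , k , j) ∷ cs) ≡ consCluster (s , k , j) (insertPart (2 + (s + w)) x cs)
insertPart-above w x s k j []      h with x ≤? s + w
... | yes x≤b = ⊥-elim (<-irrefl refl (≤-trans h (≤-trans x≤b (n≤1+n _))))
... | no _ with x ≤? suc (s + w)
...   | yes x≤b+1 = ⊥-elim (<-irrefl refl (≤-trans h x≤b+1))
...   | no _      = refl
insertPart-above w x s k j (_ ∷ _) h = refl

clustersOf-above : ∀ w s k j (acc : Σ ℕ Clusters) xs → All (2 + (s + w) ≤_) xs →
                   foldr (insertPartΣ w) (consCluster (s , k , j) acc) xs
                     ≡ consCluster (s , k , j) (foldr (insertPartΣ (2 + (s + w))) acc xs)
clustersOf-above w s k j acc []       _        = refl
clustersOf-above w s k j acc (x ∷ xs) (h ∷ hs) rewrite clustersOf-above w s k j acc xs hs =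
  insertPart-above w x s k j (proj₂ (foldr (insertPartΣ (2 + (s + w))) acc xs)) h

clustersOf-clusterBlock : ∀ w s k j → clustersOf w (clusterBlock (s + w) k j) ≡ (1 , (s , k , j) ∷ [])
clustersOf-clusterBlock w s k j =
  trans (foldr-++ (insertPartΣ w) (0 , []) (replicate j (suc (s + w))) (replicate (suc k) (s + w)))
        (trans (cong (λ acc → foldr (insertPartΣ w) acc (replicate j (suc (s + w)))) (base-copies k))
               (top-copies j))
  where
  base-copies : ∀ k → clustersOf w (replicate (suc k) (s + w)) ≡ (1 , (s , k , 0) ∷ [])
  base-copies zero rewrite m+n∸n≡m s w = refl
  base-copies (suc k) rewrite base-copies k with s + w ≤? s + w
  ... | yes _  = refl
  ... | no b≰b = ⊥-elim (b≰b ≤-refl)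

  top-copies : ∀ j → foldr (insertPartΣ w) (1 , (s , k , 0) ∷ []) (replicate j (suc (s + w))) ≡ (1 , (s , k , j) ∷ [])
  top-copies zero = refl
  top-copies (suc j) rewrite top-copies j with suc (s + w) ≤? s + w
  ... | yes b+1≤b = ⊥-elim (<-irrefl refl b+1≤b)
  ... | no _ with suc (s + w) ≤? suc (s + w)
  ...   | yes _  = refl
  ...   | no b≰b = ⊥-elim (b≰b ≤-refl)

clustersOf-clusterParts : ∀ {d} w (cs : Clusters d) → clustersOf w (clusterParts w cs) ≡ (d , cs)
clustersOf-clusterParts w []                = refl
clustersOf-clusterParts w ((s , k , j) ∷ cs)
  rewrite foldr-++ (insertPartΣ w) (0 , []) (clusterParts (2 + (s + w)) cs) (clusterBlock (s + w) k j)
        | clustersOf-clusterBlock w s k j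
        | clustersOf-above w s k j (0 , []) (clusterParts (2 + (s + w)) cs) (clusterParts-≥ (2 + (s + w)) cs)
        | clustersOf-clusterParts (2 + (s + w)) cs = refl

clusterParts-insertPart : ∀ {d} w x (cs : Clusters d) → w ≤ x → All (_≤ x) (clusterParts w cs) →
                          clusterParts w (proj₂ (insertPart w x cs)) ≡ x ∷ clusterParts w cs
clusterParts-insertPart w x [] w≤x _ = cong [_] (m∸n+n≡m w≤x)
clusterParts-insertPart w x ((s , k , j) ∷ []) w≤x x≥parts with x ≤? s + w
clusterParts-insertPart w x ((s , k , zero) ∷ []) _ (b≤x ∷ _) | yes x≤b rewrite ≤-antisym x≤b b≤x = refl
clusterParts-insertPart w x ((s , k , suc j) ∷ []) _ (b+1≤x ∷ _) | yes x≤b = ⊥-elim (<-irrefl refl (≤-trans b+1≤x x≤b))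
... | no x≰b with x ≤? suc (s + w)
...   | yes x≤b+1 rewrite ≤-antisym x≤b+1 (≰⇒> x≰b) = refl
...   | no x≰b+1  = cong (_∷ clusterBlock (s + w) k j) (m∸n+n≡m (≰⇒> x≰b+1))
clusterParts-insertPart w x ((s , k , j) ∷ c ∷ cs) w≤x x≥parts =
  cong (_++ clusterBlock (s + w) k j)
       (clusterParts-insertPart (2 + (s + w)) x (c ∷ cs) (floor≤ (2 + (s + w)) c cs x≥upper) x≥upper)
  where
  x≥upper = All.++⁻ˡ (clusterParts (2 + (s + w)) (c ∷ cs)) x≥parts
  floor≤ : ∀ {d} w c (cs : Clusters d) → All (_≤ x) (clusterParts w (c ∷ cs)) → w ≤ x
  floor≤ w (s , k , j) cs h with All.++⁻ʳ (replicate j _) (All.++⁻ʳ (clusterParts (2 + (s + w)) cs) h)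
  ... | b≤x ∷ _ = ≤-trans (m≤n+m w s) b≤x

clusterParts-clustersOf : ∀ w p → Linked _≥_ p → All (w ≤_) p → clusterParts w (proj₂ (clustersOf w p)) ≡ p
clusterParts-clustersOf w []      _ _          = refl
clusterParts-clustersOf w (x ∷ p) l (w≤x ∷ ws) =
  trans (clusterParts-insertPart w x (proj₂ (clustersOf w p)) w≤x
           (subst (All (_≤ x)) (sym ih) (nonincreasing⇒bounded l)))
        (cong (x ∷_) ih)
  where
  ih = clusterParts-clustersOf w p (Linked.tail l) ws

-- A gap-2 subsequence takes at most one part from each cluster, and the cluster bases form one.
gapSubseq-length≤ : ∀ {d} w (cs : Clusters d) {s} → s ⊆ clusterParts w cs → Gap2 s → length s ≤ d
gapSubseq-length≤ w [] [] _ = z≤n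
gapSubseq-length≤ {suc d} w ((s₀ , k , j) ∷ cs) τ g with ⊆-++-split (clusterParts (2 + (s₀ + w)) cs) τ
... | s₁ , s₂ , refl , τ₁ , τ₂ = begin
  length (s₁ ++ s₂)    ≡⟨ length-++ s₁ ⟩
  length s₁ + length s₂ ≤⟨ +-mono-≤ (gapSubseq-length≤ (2 + (s₀ + w)) cs τ₁ (Linked-++⁻ˡ s₁ g))
                                    (Gap2-within-[b,b+1] (s₀ + w) s₂ (Linked-++⁻ʳ s₁ g)
                                      (All-resp-⊆ τ₂ (clusterBlock-≥ (s₀ + w) k j)) (All-resp-⊆ τ₂ (clusterBlock-≤ (s₀ + w) k j))) ⟩
  d + 1                ≡⟨ +-comm d 1 ⟩
  suc d                ∎
  where open ≤-Reasoning

gapSubseq-of-length : ∀ {d} w (cs : Clusters d) m → m ≤ d →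
                      ∃ λ s → s ⊆ clusterParts w cs × length s ≡ m × Gap2 s × All (w ≤_) s
gapSubseq-of-length w cs zero _ = [] , []⊆-universal _ , refl , [] , []
gapSubseq-of-length w ((s₀ , k , j) ∷ cs) (suc m) (s≤s m≤d)
  with gapSubseq-of-length (2 + (s₀ + w)) cs m m≤d
... | t , τ , refl , g , t≥ =
  t ++ [ s₀ + w ] ,
  ++⁺ τ (++⁺ˡ (replicate j _) (refl ∷ []⊆-universal _)) ,
  trans (length-++ t) (+-comm (length t) 1) ,
  Gap2-∷ʳ (s₀ + w) t g t≥ ,
  All.++⁺ (All.map (≤-trans (≤-trans (m≤n+m w s₀) (m≤n+m (s₀ + w) 2))) t≥) (m≤n+m w s₀ ∷ [])

hasGapSubseq-clusterParts : ∀ {d} w (cs : Clusters d) m → HasGapSubseq m (clusterParts w cs) ⇔ m ≤ d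
hasGapSubseq-clusterParts w cs m = mk⇔ bounded attained
  where
  bounded : HasGapSubseq m (clusterParts w cs) → m ≤ _
  bounded a with subsequences⁻ (clusterParts w cs) a
  ... | s , τ , refl , g = gapSubseq-length≤ w cs τ g
  attained : m ≤ _ → HasGapSubseq m (clusterParts w cs)
  attained m≤d with gapSubseq-of-length w cs m m≤d
  ... | s , τ , len , g , _ = subsequences⁺ τ (len , g)

clusterCode : PartitionCode Clusters
clusterCode = record
  { weight           = clustersWeight 1
  ; encode           = clusterParts 1
  ; decode           = clustersOf 1
  ; encode-partition = λ cs → clusterParts-nonincreasing 1 cs , clusterParts-≥ 1 cs , sum-clusterParts 1 cs
  ; decode-encode    = clustersOf-clusterParts 1
  ; encode-decode    = λ (l , pos , _) → clusterParts-clustersOf 1 _ l pos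
  }

-- Durfee decomposition

-- (V , r) codes the partition with parts d + v₁ ≤ d + v₁ + v₂ ≤ ⋯ ≤ d + v₁ + ⋯ + v_d on top of
-- rᵢ copies of i for i = 1 … d; so d is the side of its Durfee square.
Durfee : ℕ → Set
Durfee d = Vec ℕ d × Vec ℕ d

reversed : ∀ {d} → Vec ℕ d → List ℕ
reversed v = reverse (toList v)

rows : ℕ → List ℕ → List ℕ
rows a []       = []
rows a (e ∷ es) = (e + foldr _+_ a es) ∷ rows a es

expand : ℕ → List ℕ → List ℕ
expand b []       = []
expand b (r ∷ rs) = replicate r (length rs + b) ++ expand b rs

durfeeParts : ∀ {d} → Durfee d → List ℕ
durfeeParts {d} (V , r) = rows d (reversed V) ++ expand 1 (reversed r)

-- Weights relative to a floor w, as needed when Durfee data are built cluster by cluster;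
-- for w = 1 this is the size of the coded partition.
rowsWeight : ∀ {d} → ℕ → Vec ℕ d → ℕ
rowsWeight w []      = 0
rowsWeight w (c ∷ V) = (c + w) + rowsWeight (2 + (c + w)) V

multsWeight : ∀ {d} → ℕ → Vec ℕ d → ℕ
multsWeight w []      = 0
multsWeight w (x ∷ r) = x * w + multsWeight (suc w) r

durfeeWeight : ∀ {d} → ℕ → Durfee d → ℕ
durfeeWeight w (V , r) = rowsWeight w V + multsWeight w r

durfeeSplit : ℕ → List ℕ → ℕ × List ℕ × List ℕ
durfeeSplit i []       = 0 , [] , []
durfeeSplit i (x ∷ xs) with i ≤? x
... | yes _ = let d , t , r = durfeeSplit (suc i) xs in suc d , x ∷ t , r
... | no _  = 0 , [] , x ∷ xs

rowSteps : ℕ → List ℕ → List ℕ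
rowSteps a []          = []
rowSteps a (x ∷ [])    = (x ∸ a) ∷ []
rowSteps a (x ∷ y ∷ t) = (x ∸ y) ∷ rowSteps a (y ∷ t)

copiesOf : ℕ → List ℕ → ℕ × List ℕ
copiesOf x []       = 0 , []
copiesOf x (y ∷ ys) with x ≟ y
... | yes _ = let n , rest = copiesOf x ys in suc n , rest
... | no _  = 0 , y ∷ ys

multiplicities : ℕ → List ℕ → List ℕ
multiplicities zero    r = []
multiplicities (suc v) r = let n , rest = copiesOf (suc v) r in n ∷ multiplicities v rest

-- Pads with zeros or truncates; only applied to lists of length d.
fitVec : (d : ℕ) → List ℕ → Vec ℕ d
fitVec zero    _        = []
fitVec (suc d) []       = 0 ∷ fitVec d []
fitVec (suc d) (x ∷ xs) = x ∷ fitVec d xs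

fromSplit : ℕ × List ℕ × List ℕ → Σ ℕ Durfee
fromSplit (d , t , r) = d , fitVec d (reverse (rowSteps d t)) , fitVec d (reverse (multiplicities d r))

durfeeOf : List ℕ → Σ ℕ Durfee
durfeeOf q = fromSplit (durfeeSplit 1 q)

length-reversed : ∀ {d} (v : Vec ℕ d) → length (reversed v) ≡ d
length-reversed v = trans (length-reverse (toList v)) (length-toList v)

length-rows : ∀ a es → length (rows a es) ≡ length es
length-rows a []       = refl
length-rows a (e ∷ es) = cong suc (length-rows a es)

rows-≥ : ∀ a es → All (a ≤_) (rows a es)
rows-≥ a []       = []
rows-≥ a (e ∷ es) = ≤-trans (foldr-≥ es) (m≤n+m _ e) ∷ rows-≥ a es
  where
  foldr-≥ : ∀ es → a ≤ foldr _+_ a es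
  foldr-≥ []       = ≤-refl
  foldr-≥ (e ∷ es) = ≤-trans (foldr-≥ es) (m≤n+m _ e)

rows-nonincreasing : ∀ a es → Linked _≥_ (rows a es)
rows-nonincreasing a []            = []
rows-nonincreasing a (e ∷ [])      = [-]
rows-nonincreasing a (e ∷ e′ ∷ es) = m≤n+m _ e ∷ rows-nonincreasing a (e′ ∷ es)

expand-< : ∀ b rs → All (_< length rs + b) (expand b rs)
expand-< b []       = []
expand-< b (r ∷ rs) = All.++⁺ (All.replicate⁺ r ≤-refl) (All.map (λ h → ≤-trans h (n≤1+n _)) (expand-< b rs))

expand-≥ : ∀ b rs → All (b ≤_) (expand b rs)
expand-≥ b []       = []
expand-≥ b (r ∷ rs) = All.++⁺ (All.replicate⁺ r (m≤n+m b _)) (expand-≥ b rs)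

expand-nonincreasing : ∀ b rs → Linked _≥_ (expand b rs)
expand-nonincreasing b []       = []
expand-nonincreasing b (r ∷ rs) =
  nonincreasing-++ (length rs + b) (nonincreasing-replicate r _) (All.replicate⁺ r ≤-refl)
    (expand-nonincreasing b rs) (All.map (λ h → ≤-pred (≤-trans h (n≤1+n _))) (expand-< b rs))

expand-reversed-< : ∀ {d} (r : Vec ℕ d) → All (_< suc d) (expand 1 (reversed r))
expand-reversed-< {d} r =
  subst (λ a → All (_< a) (expand 1 (reversed r))) (trans (cong (_+ 1) (length-reversed r)) (+-comm d 1))
        (expand-< 1 (reversed r))

durfeeParts-nonincreasing : ∀ {d} (y : Durfee d) → Linked _≥_ (durfeeParts y)
durfeeParts-nonincreasing {d} (V , r) =
  nonincreasing-++ d (rows-nonincreasing d (reversed V)) (rows-≥ d (reversed V))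
    (expand-nonincreasing 1 (reversed r)) (All.map ≤-pred (expand-reversed-< r))

durfeeParts-positive : ∀ {d} (y : Durfee d) → All (1 ≤_) (durfeeParts y)
durfeeParts-positive {zero}  ([] , r) = expand-≥ 1 (reversed r)
durfeeParts-positive {suc d} (V , r)  =
  All.++⁺ (All.map (≤-trans (s≤s z≤n)) (rows-≥ (suc d) (reversed V))) (expand-≥ 1 (reversed r))

rows-∷ʳ : ∀ a es c → rows a (es ++ [ c ]) ≡ rows (c + a) es ++ [ c + a ]
rows-∷ʳ a []       c = refl
rows-∷ʳ a (e ∷ es) c = cong₂ _∷_ (cong (e +_) (foldr-∷ʳ es)) (rows-∷ʳ a es c)
  where
  foldr-∷ʳ : ∀ es → foldr _+_ a (es ++ [ c ]) ≡ foldr _+_ (c + a) es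
  foldr-∷ʳ []       = refl
  foldr-∷ʳ (e ∷ es) = cong (e +_) (foldr-∷ʳ es)

rowsSum : ∀ {d} → ℕ → Vec ℕ d → ℕ
rowsSum a V = sum (rows a (reversed V))

rowsSum-∷ : ∀ {d} a c (V : Vec ℕ d) → rowsSum a (c ∷ V) ≡ rowsSum (c + a) V + (c + a)
rowsSum-∷ a c V
  rewrite unfold-reverse c (toList V) | rows-∷ʳ a (reverse (toList V)) c
        | sum-++ (rows (c + a) (reverse (toList V))) [ c + a ] | +-identityʳ (c + a) = refl

rowsSum-shift : ∀ {d} z a (V : Vec ℕ d) → rowsSum (z + a) V ≡ d * z + rowsSum a V
rowsSum-shift z a []               = refl
rowsSum-shift {suc d} z a (c ∷ V)
  rewrite rowsSum-∷ (z + a) c V | rowsSum-∷ a c V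
        | sym (+-assoc c z a) | +-comm c z | +-assoc z c a
        | rowsSum-shift z (c + a) V =
  solve 4 (λ d z R X → d :* z :+ R :+ (z :+ X) := z :+ d :* z :+ (R :+ X)) refl d z (rowsSum (c + a) V) (c + a)

rowsWeight-rowsSum : ∀ {d} w (V : Vec ℕ d) → rowsWeight (suc w) V ≡ rowsSum (d + w) V
rowsWeight-rowsSum w []              = refl
rowsWeight-rowsSum {suc d} w (c ∷ V) = begin
  (c + suc w) + rowsWeight (2 + (c + suc w)) V     ≡⟨ cong ((c + suc w) +_) (rowsWeight-rowsSum (suc (c + suc w)) V) ⟩
  (c + suc w) + rowsSum (d + suc (c + suc w)) V     ≡⟨ cong (λ a → (c + suc w) + rowsSum a V) shuffle ⟩
  (c + suc w) + rowsSum (1 + (c + (suc d + w))) V   ≡⟨ cong ((c + suc w) +_) (rowsSum-shift 1 (c + (suc d + w)) V) ⟩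
  (c + suc w) + (d * 1 + rowsSum (c + (suc d + w)) V)
    ≡⟨ solve 4 (λ c w d R → c :+ (con 1 :+ w) :+ (d :* con 1 :+ R) := R :+ (c :+ (con 1 :+ d :+ w)))
             refl c w d (rowsSum (c + (suc d + w)) V) ⟩
  rowsSum (c + (suc d + w)) V + (c + (suc d + w))   ≡⟨ sym (rowsSum-∷ (suc d + w) c V) ⟩
  rowsSum (suc d + w) (c ∷ V)                       ∎
  where
  open ≡-Reasoning
  shuffle : d + suc (c + suc w) ≡ 1 + (c + (suc d + w))
  shuffle = solve 3 (λ d c w → d :+ (con 1 :+ (c :+ (con 1 :+ w))) := con 1 :+ (c :+ (con 1 :+ d :+ w))) refl d c w

expand-∷ʳ : ∀ b rs r → expand b (rs ++ [ r ]) ≡ expand (suc b) rs ++ replicate r b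
expand-∷ʳ b []       r = ++-identityʳ (replicate r b)
expand-∷ʳ b (x ∷ rs) r
  rewrite expand-∷ʳ b rs r | length-++ rs {[ r ]} | +-assoc (length rs) 1 b =
  sym (++-assoc (replicate x (length rs + suc b)) (expand (suc b) rs) (replicate r b))

sum-expand : ∀ {d} b (r : Vec ℕ d) → sum (expand b (reversed r)) ≡ multsWeight b r
sum-expand b []      = refl
sum-expand b (x ∷ r)
  rewrite unfold-reverse x (toList r) | expand-∷ʳ b (reverse (toList r)) x
        | sum-++ (expand (suc b) (reverse (toList r))) (replicate x b)
        | sum-replicate x b | sum-expand (suc b) r = +-comm (multsWeight (suc b) r) (x * b)

sum-durfeeParts : ∀ {d} (y : Durfee d) → sum (durfeeParts y) ≡ durfeeWeight 1 y
sum-durfeeParts {d} (V , r)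
  rewrite sum-++ (rows d (reversed V)) (expand 1 (reversed r)) | sum-expand 1 r
        | rowsWeight-rowsSum 0 V | +-identityʳ d = refl

fitVec-toList : ∀ {d} (v : Vec ℕ d) → fitVec d (toList v) ≡ v
fitVec-toList []      = refl
fitVec-toList (x ∷ v) = cong (x ∷_) (fitVec-toList v)

fitVec-reversed : ∀ {d} (v : Vec ℕ d) → fitVec d (reverse (reversed v)) ≡ v
fitVec-reversed v = trans (cong (fitVec _) (reverse-involutive (toList v))) (fitVec-toList v)

durfeeSplit-++ : ∀ i d t r → length t ≡ d → All (λ x → d + i ≤ suc x) t → All (_< d + i) r →
                 durfeeSplit i (t ++ r) ≡ (d , t , r)
durfeeSplit-++ i zero [] [] _ _ _ = refl
durfeeSplit-++ i zero [] (y ∷ r) _ _ (y<i ∷ _) with i ≤? y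
... | yes i≤y = ⊥-elim (<-irrefl refl (≤-trans y<i i≤y))
... | no _    = refl
durfeeSplit-++ i (suc d) (x ∷ t) r len (hx ∷ ht) hr with i ≤? x
... | no i≰x = ⊥-elim (i≰x (≤-trans (m≤n+m i d) (≤-pred hx)))
... | yes _  = cong (λ (d , t , r) → suc d , x ∷ t , r)
    (durfeeSplit-++ (suc i) d t r (suc-injective len)
      (All.map (λ {y} h → subst (_≤ suc y) (sym (+-suc d i)) h) ht)
      (All.map (λ {y} h → subst (y <_) (sym (+-suc d i)) h) hr))

copiesOf-replicate : ∀ x n ys → All (_< x) ys → copiesOf x (replicate n x ++ ys) ≡ (n , ys)
copiesOf-replicate x zero []       _          = refl
copiesOf-replicate x zero (y ∷ ys) (y<x ∷ _) with x ≟ y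
... | yes x≡y = ⊥-elim (<-irrefl (sym x≡y) y<x)
... | no _    = refl
copiesOf-replicate x (suc n) ys h with x ≟ x
... | yes _  = cong (λ (n , ys) → suc n , ys) (copiesOf-replicate x n ys h)
... | no x≢x = ⊥-elim (x≢x refl)

length-multiplicities : ∀ v r → length (multiplicities v r) ≡ v
length-multiplicities zero    r = refl
length-multiplicities (suc v) r = cong suc (length-multiplicities v _)

multiplicities-expand : ∀ v rs → length rs ≡ v → multiplicities v (expand 1 rs) ≡ rs
multiplicities-expand zero    []       _   = refl
multiplicities-expand (suc v) (r ∷ rs) len
  rewrite suc-injective len | +-comm v 1
        | copiesOf-replicate (suc v) r (expand 1 rs)
            (subst (λ a → All (_< a) (expand 1 rs)) (trans (cong (_+ 1) (suc-injective len)) (+-comm v 1))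
                   (expand-< 1 rs))
  = cong (r ∷_) (multiplicities-expand v rs (suc-injective len))

rowSteps-rows : ∀ a es → rowSteps a (rows a es) ≡ es
rowSteps-rows a []            = refl
rowSteps-rows a (e ∷ [])      = cong [_] (m+n∸n≡m e a)
rowSteps-rows a (e ∷ e′ ∷ es) = cong₂ _∷_ (m+n∸n≡m e (e′ + foldr _+_ a es)) (rowSteps-rows a (e′ ∷ es))

durfeeOf-durfeeParts : ∀ {d} (y : Durfee d) → durfeeOf (durfeeParts y) ≡ (d , y)
durfeeOf-durfeeParts {d} (V , r) =
  trans (cong fromSplit (durfeeSplit-++ 1 d (rows d (reversed V)) (expand 1 (reversed r))
                           (trans (length-rows d (reversed V)) (length-reversed V))
                           (All.map (λ {x} h → subst (_≤ suc x) (+-comm 1 d) (s≤s h)) (rows-≥ d (reversed V)))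
                           (subst (λ a → All (_< a) (expand 1 (reversed r))) (cong (_+ 1) (length-reversed r))
                                  (expand-< 1 (reversed r)))))
        (cong₂ (λ V r → d , V , r)
          (trans (cong (fitVec d ∘ reverse) (rowSteps-rows d (reversed V))) (fitVec-reversed V))
          (trans (cong (fitVec d ∘ reverse) (multiplicities-expand d (reversed r) (length-reversed r)))
                 (fitVec-reversed r)))

toList-fitVec : ∀ d xs → length xs ≡ d → toList (fitVec d xs) ≡ xs
toList-fitVec zero    []       _   = refl
toList-fitVec (suc d) (x ∷ xs) len = cong (x ∷_) (toList-fitVec d xs (suc-injective len))

reversed-fitVec : ∀ d xs → length xs ≡ d → reversed (fitVec d (reverse xs)) ≡ xs
reversed-fitVec d xs len =
  trans (cong reverse (toList-fitVec d (reverse xs) (trans (length-reverse xs) len))) (reverse-involutive xs)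

IsDurfeeSplit : ℕ → List ℕ → ℕ × List ℕ × List ℕ → Set
IsDurfeeSplit i q (d , t , r) =
  q ≡ t ++ r × length t ≡ d × All (λ x → d + i ≤ suc x) t × All (_< d + i) r

durfeeSplit-correct : ∀ i q → Linked _≥_ q → IsDurfeeSplit i q (durfeeSplit i q)
durfeeSplit-correct i []       l = refl , refl , [] , []
durfeeSplit-correct i (x ∷ xs) l with i ≤? x
... | no i≰x = refl , refl , [] , (≰⇒> i≰x ∷ All.map (λ h → ≤-trans (s≤s h) (≰⇒> i≰x)) (nonincreasing⇒bounded l))
... | yes i≤x with durfeeSplit (suc i) xs | durfeeSplit-correct (suc i) xs (Linked.tail l)
...   | d , t , r | refl , refl , ht , hr =
  refl , refl , head-fits t i≤x ht (All.++⁻ˡ t (nonincreasing⇒bounded l)) ∷ All.map (λ {y} → shift (_≤ suc y)) ht ,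
  All.map (λ {y} → shift (y <_)) hr
  where
  shift : (P : ℕ → Set) → P (d + suc i) → P (suc d + i)
  shift P = subst P (+-suc d i)
  head-fits : ∀ t → i ≤ x → All (λ y → length t + suc i ≤ suc y) t → All (_≤ x) t → suc (length t) + i ≤ suc x
  head-fits []      i≤x _        _          = s≤s i≤x
  head-fits t@(y ∷ _) _ (hy ∷ _) (y≤x ∷ _) = ≤-trans (subst (_≤ suc y) (+-suc (length t) i) hy) (s≤s y≤x)

rows-rowSteps : ∀ a t → Linked _≥_ t → All (a ≤_) t → rows a (rowSteps a t) ≡ t
rows-rowSteps a []          _        _          = refl
rows-rowSteps a (x ∷ [])    _        (a≤x ∷ _)  = cong [_] (m∸n+n≡m a≤x)
rows-rowSteps a (x ∷ y ∷ t) (y≤x ∷ l) (_ ∷ hs) =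
  cong₂ _∷_ (trans (cong ((x ∸ y) +_) (top (rowSteps a (y ∷ t)) ih)) (m∸n+n≡m y≤x)) ih
  where
  ih = rows-rowSteps a (y ∷ t) l hs
  top : ∀ es → rows a es ≡ y ∷ t → foldr _+_ a es ≡ y
  top (e ∷ es) eq = cong (λ { [] → 0 ; (z ∷ _) → z }) eq

copiesOf-correct : ∀ x r → Linked _≥_ r → All (_≤ x) r →
                   let n , rest = copiesOf x r in r ≡ replicate n x ++ rest × All (_< x) rest
copiesOf-correct x []       _ _          = refl , []
copiesOf-correct x (y ∷ ys) l (y≤x ∷ hs) with x ≟ y
... | no x≢y  = refl , (y<x ∷ All.map (λ h → ≤-trans (s≤s h) y<x) (nonincreasing⇒bounded l))
  where y<x = ≤∧≢⇒< y≤x (λ y≡x → x≢y (sym y≡x))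
... | yes refl with copiesOf x ys | copiesOf-correct x ys (Linked.tail l) hs
...   | n , rest | refl , h = refl , h

expand-multiplicities : ∀ v r → Linked _≥_ r → All (1 ≤_) r → All (_≤ v) r → expand 1 (multiplicities v r) ≡ r
expand-multiplicities zero    []      _ _          _          = refl
expand-multiplicities zero    (x ∷ r) _ (1≤x ∷ _) (x≤0 ∷ _) = ⊥-elim (<-irrefl refl (≤-trans 1≤x x≤0))
expand-multiplicities (suc v) r l pos r≤v with copiesOf (suc v) r | copiesOf-correct (suc v) r l r≤v
... | n , rest | refl , rest<v =
  cong₂ (λ a b → replicate n a ++ b)
        (trans (cong (_+ 1) (length-multiplicities v rest)) (+-comm v 1))
        (expand-multiplicities v rest (Linked-++⁻ʳ (replicate n (suc v)) l)
           (All.++⁻ʳ (replicate n (suc v)) pos) (All.map ≤-pred rest<v))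

durfeeParts-durfeeOf : ∀ q → Linked _≥_ q → All (1 ≤_) q → durfeeParts (proj₂ (durfeeOf q)) ≡ q
durfeeParts-durfeeOf q l pos with durfeeSplit 1 q | durfeeSplit-correct 1 q l
... | d , t , r | refl , len , ht , hr =
  cong₂ _++_
    (trans (cong (rows d) (reversed-fitVec d (rowSteps d t) (trans (length-rowSteps d t) len)))
           (rows-rowSteps d t (Linked-++⁻ˡ t l) (All.map (λ {x} h → ≤-pred (subst (_≤ suc x) (+-comm d 1) h)) ht)))
    (trans (cong (expand 1) (reversed-fitVec d (multiplicities d r) (length-multiplicities d r)))
           (expand-multiplicities d r (Linked-++⁻ʳ t l) (All.++⁻ʳ t pos)
              (All.map (λ {x} h → ≤-pred (subst (x <_) (+-comm d 1) h)) hr)))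
  where
  length-rowSteps : ∀ a t → length (rowSteps a t) ≡ length t
  length-rowSteps a []          = refl
  length-rowSteps a (x ∷ [])    = refl
  length-rowSteps a (x ∷ y ∷ t) = cong suc (length-rowSteps a (y ∷ t))

-- The first d parts are ≥ d and all the others are ≤ d.
countGe-durfeeParts : ∀ {d} m (y : Durfee d) → m ≤ countGe m (durfeeParts y) ⇔ m ≤ d
countGe-durfeeParts {d} m (V , r) = mk⇔ bounded attained
  where
  tall = rows d (reversed V)
  short = expand 1 (reversed r)
  count-tall : m ≤ d → countGe m (tall ++ short) ≡ d + length (filter (m ≤?_) short)
  count-tall m≤d
    rewrite filter-++ (m ≤?_) tall short | length-++ (filter (m ≤?_) tall) {filter (m ≤?_) short}
          | filter-all (m ≤?_) (All.map (≤-trans m≤d) (rows-≥ d (reversed V)))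
          | length-rows d (reversed V) | length-reversed V = refl
  count-short : d < m → countGe m (tall ++ short) ≤ d
  count-short d<m
    rewrite filter-++ (m ≤?_) tall short | length-++ (filter (m ≤?_) tall) {filter (m ≤?_) short}
          | filter-none (m ≤?_) (All.map (λ x<d+1 m≤x → <-irrefl refl (≤-trans d<m (≤-trans m≤x (≤-pred x<d+1))))
                                        (expand-reversed-< r))
          | +-identityʳ (length (filter (m ≤?_) tall)) =
    ≤-trans (length-filter (m ≤?_) tall) (≤-reflexive (trans (length-rows d (reversed V)) (length-reversed V)))
  bounded : m ≤ countGe m (durfeeParts (V , r)) → m ≤ d
  bounded h = ≮⇒≥ (λ d<m → ≤⇒≯ (≤-trans h (count-short d<m)) d<m)
  attained : m ≤ d → m ≤ countGe m (durfeeParts (V , r))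
  attained m≤d = subst (m ≤_) (sym (count-tall m≤d)) (≤-trans m≤d (m≤m+n d _))

durfeeCode : PartitionCode Durfee
durfeeCode = record
  { weight           = durfeeWeight 1
  ; encode           = durfeeParts
  ; decode           = durfeeOf
  ; encode-partition = λ y → durfeeParts-nonincreasing y , durfeeParts-positive y , sum-durfeeParts y
  ; decode-encode    = durfeeOf-durfeeParts
  ; encode-decode    = λ (l , pos , _) → durfeeParts-durfeeOf _ l pos
  }

-- From clusters to Durfee data

absorbLast : ∀ {d} → ℕ → Vec ℕ d → ℕ → Vec ℕ (suc d) → Durfee (suc d)
absorbLast c V x ts = (c + last ts) ∷ V , (x + last ts) ∷ init ts

lowerFloor : ∀ {d} → Durfee (suc d) → Durfee (suc d)
lowerFloor (c ∷ V , r) = absorbLast (suc c) V 0 r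

addCluster : ∀ {d} → Cluster → Durfee d → Durfee (suc d)
addCluster (zero , k , j)  (V , r) = absorbLast 0 V k (j ∷ r)
addCluster (suc s , k , j) y       = lowerFloor (addCluster (s , k , j) y)

clustersToDurfee : ∀ {d} → Clusters d → Durfee d
clustersToDurfee []       = [] , []
clustersToDurfee (c ∷ cs) = addCluster c (clustersToDurfee cs)

firstStep : ∀ {d} → Durfee (suc d) → ℕ
firstStep (V , _) = head V

raiseOffset : ∀ {d} → Cluster × Durfee d → Cluster × Durfee d
raiseOffset ((s , k , j) , y) = (suc s , k , j) , y

bottomCluster : ∀ {d} → Vec ℕ d → ℕ → Vec ℕ (suc d) → Cluster × Durfee d
bottomCluster V k (j ∷ r) = (0 , k , j) , (V , r)

-- An application of lowerFloor is recognised by v₁ exceeding r₁; undoing it decreases v₁,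
-- which therefore bounds the recursion depth (the fuel).
removeCluster : ∀ {d} → ℕ → Durfee (suc d) → Cluster × Durfee d
removeCluster fuel (c ∷ V , m ∷ rs) with c ≤? m
... | yes _ = bottomCluster V (m ∸ c) (rs ∷ʳ c)
removeCluster zero       (c ∷ V , m ∷ rs) | no _ = (0 , 0 , 0) , (V , rs)
removeCluster (suc fuel) (c ∷ V , m ∷ rs) | no _ = raiseOffset (removeCluster fuel (c ∸ suc m ∷ V , rs ∷ʳ m))

durfeeToClusters : ∀ {d} → Durfee d → Clusters d
durfeeToClusters {zero}  _ = []
durfeeToClusters {suc d} y = let c , y′ = removeCluster (firstStep y) y in c ∷ durfeeToClusters y′

∷ʳ-init-last : ∀ {d} (ts : Vec ℕ (suc d)) → init ts ∷ʳ last ts ≡ ts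
∷ʳ-init-last ts = sym (proj₂ (proj₂ (initLast ts)))

removeCluster-lowerFloor : ∀ {d} (y : Durfee (suc d)) f → firstStep (lowerFloor y) ≤ f →
                           firstStep y ≤ pred f × removeCluster f (lowerFloor y) ≡ raiseOffset (removeCluster (pred f) y)
removeCluster-lowerFloor (c ∷ V , r) (suc f) (s≤s h) with suc c + last r ≤? 0 + last r
... | yes c+1≤0 = contradiction (+-cancelʳ-≤ (last r) (suc c) 0 c+1≤0) λ ()
... | no _      = ≤-trans (m≤m+n c (last r)) h ,
                  cong raiseOffset (cong₂ (λ a b → removeCluster f (a ∷ V , b)) (m+n∸n≡m c (last r)) (∷ʳ-init-last r))

removeCluster-addCluster : ∀ {d} s k j (y : Durfee d) f → firstStep (addCluster (s , k , j) y) ≤ f →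
                           removeCluster f (addCluster (s , k , j) y) ≡ ((s , k , j) , y)
removeCluster-addCluster zero k j (V , r) f h with last (j ∷ r) ≤? k + last (j ∷ r)
... | no L≰k+L = ⊥-elim (L≰k+L (m≤n+m _ k))
... | yes _ rewrite ∷ʳ-init-last (j ∷ r) | m+n∸n≡m k (last (j ∷ r)) = refl
removeCluster-addCluster (suc s) k j y f h with removeCluster-lowerFloor (addCluster (s , k , j) y) f h
... | h′ , eq = trans eq (cong raiseOffset (removeCluster-addCluster s k j y (pred f) h′))

addCluster-raiseOffset : ∀ {d} (cy : Cluster × Durfee d) → uncurry addCluster (raiseOffset cy) ≡ lowerFloor (uncurry addCluster cy)
addCluster-raiseOffset ((s , k , j) , y) = refl

addCluster-bottomCluster : ∀ {d} (V : Vec ℕ d) k (ts : Vec ℕ (suc d)) → uncurry addCluster (bottomCluster V k ts) ≡ absorbLast 0 V k ts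
addCluster-bottomCluster V k (j ∷ r) = refl

addCluster-removeCluster : ∀ {d} f (y : Durfee (suc d)) → firstStep y ≤ f → uncurry addCluster (removeCluster f y) ≡ y
addCluster-removeCluster f (c ∷ V , m ∷ rs) h with c ≤? m
... | yes c≤m rewrite addCluster-bottomCluster V (m ∸ c) (rs ∷ʳ c) | last-∷ʳ c rs | init-∷ʳ c rs | m∸n+n≡m c≤m = refl
addCluster-removeCluster zero    (c ∷ V , m ∷ rs) c≤0   | no c≰m = ⊥-elim (c≰m (≤-trans c≤0 z≤n))
addCluster-removeCluster (suc f) (c ∷ V , m ∷ rs) c≤f+1 | no c≰m
  rewrite addCluster-raiseOffset (removeCluster f (c ∸ suc m ∷ V , rs ∷ʳ m))
        | addCluster-removeCluster f (c ∸ suc m ∷ V , rs ∷ʳ m) (≤-trans (∸-monoʳ-≤ c (s≤s z≤n)) (∸-monoˡ-≤ 1 c≤f+1))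
        | last-∷ʳ m rs | init-∷ʳ m rs =
  cong (λ a → a ∷ V , m ∷ rs) (trans (sym (+-suc (c ∸ suc m) m)) (m∸n+n≡m (≰⇒> c≰m)))

durfeeToClusters-clustersToDurfee : ∀ {d} (cs : Clusters d) → durfeeToClusters (clustersToDurfee cs) ≡ cs
durfeeToClusters-clustersToDurfee []       = refl
durfeeToClusters-clustersToDurfee ((s , k , j) ∷ cs)
  rewrite removeCluster-addCluster s k j (clustersToDurfee cs) (firstStep (addCluster (s , k , j) (clustersToDurfee cs))) ≤-refl =
  cong ((s , k , j) ∷_) (durfeeToClusters-clustersToDurfee cs)

clustersToDurfee-durfeeToClusters : ∀ {d} (y : Durfee d) → clustersToDurfee (durfeeToClusters y) ≡ y
clustersToDurfee-durfeeToClusters {zero}  ([] , []) = refl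
clustersToDurfee-durfeeToClusters {suc d} y
  rewrite clustersToDurfee-durfeeToClusters (proj₂ (removeCluster (firstStep y) y)) =
  addCluster-removeCluster (firstStep y) y ≤-refl

clusters↔durfee : ∀ {d} → Clusters d ↔ Durfee d
clusters↔durfee = mk↔ₛ′ clustersToDurfee durfeeToClusters clustersToDurfee-durfeeToClusters durfeeToClusters-clustersToDurfee

rowsWeight-shift : ∀ {d} z w (V : Vec ℕ d) → rowsWeight (z + w) V ≡ d * z + rowsWeight w V
rowsWeight-shift z w []              = refl
rowsWeight-shift {suc d} z w (c ∷ V) = begin
  (c + (z + w)) + rowsWeight (2 + (c + (z + w))) V ≡⟨ cong (λ a → (c + (z + w)) + rowsWeight a V) shuffle ⟩
  (c + (z + w)) + rowsWeight (z + (2 + (c + w))) V ≡⟨ cong ((c + (z + w)) +_) (rowsWeight-shift z (2 + (c + w)) V) ⟩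
  (c + (z + w)) + (d * z + rowsWeight (2 + (c + w)) V)
    ≡⟨ solve 5 (λ z c w d R → c :+ (z :+ w) :+ (d :* z :+ R) := z :+ d :* z :+ (c :+ w :+ R))
             refl z c w d (rowsWeight (2 + (c + w)) V) ⟩
  suc d * z + ((c + w) + rowsWeight (2 + (c + w)) V) ∎
  where
  open ≡-Reasoning
  shuffle : 2 + (c + (z + w)) ≡ z + (2 + (c + w))
  shuffle = solve 3 (λ c z w → con 2 :+ (c :+ (z :+ w)) := z :+ (con 2 :+ (c :+ w))) refl c z w

multsWeight-init-last : ∀ {d} w (ts : Vec ℕ (suc d)) → multsWeight w ts ≡ multsWeight w (init ts) + last ts * (d + w)
multsWeight-init-last w (x ∷ [])             = solve 2 (λ x w → x :* w :+ con 0 := con 0 :+ x :* w) refl x w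
multsWeight-init-last {suc d} w (x ∷ y ∷ ys) rewrite multsWeight-init-last (suc w) (y ∷ ys) | +-suc d w =
  sym (+-assoc (x * w) _ _)

-- The z = last ts parts d + 1 + w become z parts w, plus z more in each of the d + 1 rows.
absorbLast-weight : ∀ {d} w c (V : Vec ℕ d) x (ts : Vec ℕ (suc d)) →
                    durfeeWeight w (absorbLast c V x ts) ≡ rowsWeight w (c ∷ V) + multsWeight w (x ∷ ts)
absorbLast-weight {d} w c V x ts = begin
  ((c + z) + w) + rowsWeight (2 + ((c + z) + w)) V + ((x + z) * w + M)
    ≡⟨ cong (λ a → ((c + z) + w) + rowsWeight a V + ((x + z) * w + M)) shuffle ⟩
  ((c + z) + w) + rowsWeight (z + (2 + (c + w))) V + ((x + z) * w + M)
    ≡⟨ cong (λ a → ((c + z) + w) + a + ((x + z) * w + M)) (rowsWeight-shift z (2 + (c + w)) V) ⟩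
  ((c + z) + w) + (d * z + S) + ((x + z) * w + M)
    ≡⟨ solve 7 (λ c w z d S x M → c :+ z :+ w :+ (d :* z :+ S) :+ ((x :+ z) :* w :+ M)
                                := c :+ w :+ S :+ (x :* w :+ (M :+ z :* (d :+ (con 1 :+ w)))))
             refl c w z d S x M ⟩
  (c + w) + S + (x * w + (M + z * (d + suc w)))
    ≡⟨ cong (λ a → (c + w) + S + (x * w + a)) (sym (multsWeight-init-last (suc w) ts)) ⟩
  (c + w) + S + (x * w + multsWeight (suc w) ts) ∎
  where
  open ≡-Reasoning
  z = last ts
  S = rowsWeight (2 + (c + w)) V
  M = multsWeight (suc w) (init ts)
  shuffle : 2 + ((c + z) + w) ≡ z + (2 + (c + w))
  shuffle = solve 3 (λ c z w → con 2 :+ ((c :+ z) :+ w) := z :+ (con 2 :+ (c :+ w))) refl c z w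

lowerFloor-weight : ∀ {d} w (y : Durfee (suc d)) → durfeeWeight w (lowerFloor y) ≡ durfeeWeight (suc w) y
lowerFloor-weight w (c ∷ V , r) rewrite absorbLast-weight w (suc c) V 0 r | +-suc c w = refl

addCluster-weight : ∀ {d} w s k j (y : Durfee d) →
                    durfeeWeight w (addCluster (s , k , j) y) ≡ suc k * (s + w) + j * suc (s + w) + durfeeWeight (2 + (s + w)) y
addCluster-weight w zero k j (V , r) rewrite absorbLast-weight w 0 V k (j ∷ r) =
  solve 5 (λ w S k j T → w :+ S :+ (k :* w :+ (j :* (con 1 :+ w) :+ T))
                       := w :+ k :* w :+ j :* (con 1 :+ w) :+ (S :+ T))
        refl w (rowsWeight (2 + w) V) k j (multsWeight (2 + w) r)
addCluster-weight w (suc s) k j y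
  rewrite lowerFloor-weight w (addCluster (s , k , j) y) | addCluster-weight (suc w) s k j y | +-suc s w = refl

clustersToDurfee-weight : ∀ {d} w (cs : Clusters d) → durfeeWeight w (clustersToDurfee cs) ≡ clustersWeight w cs
clustersToDurfee-weight w []                = refl
clustersToDurfee-weight w ((s , k , j) ∷ cs)
  rewrite addCluster-weight w s k j (clustersToDurfee cs) | clustersToDurfee-weight (2 + (s + w)) cs = refl

theorem5 : (n m : ℕ) → 1 ≤ m → C m n ↔ D m n
theorem5 n m _ = begin
  C m n                ↔⟨ partitions↔codes clusterCode _ T-irrelevant gapSubseq⇔ ⟩
  Codes clusterCode n m ↔⟨ Codes-↔ clusterCode durfeeCode clusters↔durfee (clustersToDurfee-weight 1) ⟩
  Codes durfeeCode n m  ↔⟨ partitions↔codes durfeeCode _ ≤-irrelevant (countGe-durfeeParts m) ⟨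
  D m n                ∎
  where
  open EquationalReasoning
  gapSubseq⇔ : ∀ {d} (cs : Clusters d) → T ⌊ hasGapSubseq? m (clusterParts 1 cs) ⌋ ⇔ m ≤ d
  gapSubseq⇔ cs = ⇔.trans (mk⇔ toWitness fromWitness) (hasGapSubseq-clusterParts 1 cs m)
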